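{- Let $w$ be a string over a totally ordered alphabet of size $\sigma$, and let $\mathsf{OPST}(w)$ be its order-preserving suffix tree (defined in the context). Then any root-to-leaf path in $\mathsf{OPST}(w)$ contains at most $\sigma$ explicit non-branching nodes; in particular, there are at most $\sigma$ explicit non-branching nodes between any two branching nodes.
   Context: Strings are indexed from $0$; $w=w[0..n-1]$ and $w[i..j]$ is a fragment. The symbol $\perp$ denotes "undefined". For a nonempty string $x$ of length $m$: $p(x)$ is the largest $j\le m-2$ such that $x[j]=\max\{x[k]: k\le m-2,\ x[k]\le x[m-1]\}$, or $\perp$ if no such $j$ exists; $s(x)$ is the largest $j\le m-2$ such that $x[j]=\min\{x[k]: k\le m-2,\ x[k]\ge x[m-1]\}$, or $\perp$ if none. $\mathsf{LastCode}(x)=(p(x),s(x))$ and $\mathsf{PrefCode}(x)=\mathsf{LastCode}(x[0..0])\cdots\mathsf{LastCode}(x[0..m-1])$. Two equal-length strings are order-preserving ($x\approx y$) iff $x[i]\le x[j]\iff y[i]\le y[j]$ for all $i,j$; equivalently $\mathsf{PrefCode}(x)=\mathsf{PrefCode}(y)$. With a delimiter $\$$, consider the trie of the sequences $\mathsf{PrefCode}(w[i..n-1])\$$, $0\le i\le n-1$; each trie node represents a distinct prefix of one of these sequences, i.e. some $\mathsf{PrefCode}(w[i..j])$ (or a full sequence ending in $\$$, which is a leaf). A node is branching if it has at least two children. Every branching node $v$ representing $\mathsf{PrefCode}(w[i..j])$ has a suffix link to the node representing $\mathsf{PrefCode}(w[i+1..j])$ (well defined since it does not depend on the choice of $i,j$).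 The explicit nodes are: the root, the branching nodes, the leaves, and the targets of suffix links of branching nodes. $\mathsf{OPST}(w)$ is the tree obtained by keeping only explicit nodes (all other nodes are dissolved into edges). An explicit non-branching node is an explicit node other than the root and the leaves that has exactly one child (such nodes exist only because they are suffix-link targets). -}

module Defs where

open import Data.Nat using (ℕ; zero; suc; _+_; _∸_; _≤_; _<_; _≤ᵇ_)
open import Data.Bool using (Bool; true; false; if_then_else_)
open import Data.Fin using (Fin; toℕ)
open import Data.List using (List; []; _∷_; _++_; [_]; map; take; drop; length; upTo; last)
open import Data.Maybe using (Maybe; just; nothing)
open import Data.Product using (_×_; _,_; proj₁; ∃; ∃-syntax; Σ-syntax)
open import Data.Sum using (_⊎_)
open import Relation.Binary.PropositionalEquality using (_≡_; _≢_)
open import Relation.Nullary using (¬_)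

-- Letters are compared through their natural-number values (toℕ for Fin σ).

-- Scan for p: among y_k ≤ c keep the maximal value, the largest index on ties.
-- Accumulator holds (index, value) of the current best.
pGo : ℕ → ℕ → Maybe (ℕ × ℕ) → List ℕ → Maybe (ℕ × ℕ)
pGo c k best [] = best
pGo c k best (y ∷ ys) with y ≤ᵇ c | best
... | false | _ = pGo c (suc k) best ys
... | true | nothing = pGo c (suc k) (just (k , y)) ys
... | true | just (j , b) =
  if b ≤ᵇ y then pGo c (suc k) (just (k , y)) ys else pGo c (suc k) best ys

-- Scan for s: among y_k ≥ c keep the minimal value, the largest index on ties.
sGo : ℕ → ℕ → Maybe (ℕ × ℕ) → List ℕ → Maybe (ℕ × ℕ)
sGo c k best [] = best
sGo c k best (y ∷ ys) with c ≤ᵇ y | best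
... | false | _ = sGo c (suc k) best ys
... | true | nothing = sGo c (suc k) (just (k , y)) ys
... | true | just (j , b) =
  if y ≤ᵇ b then sGo c (suc k) (just (k , y)) ys else sGo c (suc k) best ys

mfst : Maybe (ℕ × ℕ) → Maybe ℕ
mfst nothing = nothing
mfst (just (j , _)) = just j

-- nothing plays the role of ⊥.
Code : Set
Code = Maybe ℕ × Maybe ℕ

-- LastCode(x) = (p(x), s(x)) for nonempty x; x[0..m-2] = take (m-1) x, x[m-1] = last x.
lastCode : List ℕ → Code
lastCode x with last x
... | nothing = (nothing , nothing)
... | just c = let ini = take (length x ∸ 1) x in
  (mfst (pGo c 0 nothing ini) , mfst (sGo c 0 nothing ini))

prefCode : List ℕ → List Code
prefCode x = map (λ k → lastCode (take (suc k) x)) (upTo (length x))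

data Sym : Set where
  code   : Code → Sym
  dollar : Sym

_⊑_ : List Sym → List Sym → Set
u ⊑ v = ∃[ t ] (u ++ t ≡ v)

module _ {σ : ℕ} (w : List (Fin σ)) where

  n : ℕ
  n = length w

  wℕ : List ℕ
  wℕ = map toℕ w

  frag : ℕ → ℕ → List ℕ
  frag i ℓ = take ℓ (drop i wℕ)

  codes : List ℕ → List Sym
  codes x = map code (prefCode x)

  Seq : ℕ → List Sym
  Seq i = codes (drop i wℕ) ++ [ dollar ]

  -- nodes of the trie: prefixes of some Seq i (0 ≤ i ≤ n-1)
  IsNode : List Sym → Set
  IsNode u = ∃[ i ] (i < n × u ⊑ Seq i)

  IsRoot : List Sym → Set
  IsRoot u = u ≡ []

  IsLeaf : List Sym → Set
  IsLeaf u = ∃[ i ] (i < n × u ≡ Seq i)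

  Branching : List Sym → Set
  Branching u = IsNode u × ∃[ a ] ∃[ b ] (a ≢ b × IsNode (u ++ [ a ]) × IsNode (u ++ [ b ]))

  OneChild : List Sym → Set
  OneChild u = ∃[ a ] (IsNode (u ++ [ a ]) × (∀ b → IsNode (u ++ [ b ]) → b ≡ a))

  -- u is the target of the suffix link of a branching node
  -- PrefCode(w[i..j]) ↦ PrefCode(w[i+1..j]), here with j = i+ℓ-1, ℓ ≥ 1
  SuffixLinkTarget : List Sym → Set
  SuffixLinkTarget u = ∃[ i ] ∃[ ℓ ]
    (1 ≤ ℓ × i + ℓ ≤ n × Branching (codes (frag i ℓ)) × u ≡ codes (frag (suc i) (ℓ ∸ 1)))

  Explicit : List Sym → Set
  Explicit u = IsNode u × (IsRoot u ⊎ Branching u ⊎ IsLeaf u ⊎ SuffixLinkTarget u)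

  ExplicitNonBranching : List Sym → Set
  ExplicitNonBranching u = Explicit u × ¬ IsRoot u × ¬ IsLeaf u × OneChild u

{-# OPTIONS --safe #-}
module Submission where

-- Fix a leaf path PrefCode(D)$, D a suffix of w. An explicit non-branching node u on it has a
-- single child c and, not being branching, is the suffix-link target of a branching node
-- PrefCode(xU) with u = PrefCode(U). Read two distinct children a ≠ b of PrefCode(xU) at
-- occurrences yQz and y'Q'z' of xU followed by one more letter; shifted by one position they
-- give children of u, so both equal c and Qz ≈ Q'z'. If z occurred in Q, the comparisons of y
-- with z would be dictated by yQ ≈ y'Q', so yQz ≈ y'Q'z' and a = b. Hence z is new in Qz, and as
-- the path also continues u by c, the letter of D following u is the first occurrence of that
-- letter in D. Distinct such nodes give distinct letters, so there are at most σ of them; nodes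
-- between two branching nodes lie on a single leaf path.

open import Defs
open import Data.Nat using (ℕ; zero; suc; _∸_; _≤_; _<_; _≤ᵇ_; z≤n; s≤s)
open import Data.Nat.Properties
open import Data.Fin using (Fin; toℕ)
open import Data.Fin.Properties using (toℕ<n)
open import Data.Bool using (Bool; true; false; T; if_then_else_)
open import Data.Bool.Properties using (T-≡)
open import Data.Unit using (⊤; tt)
open import Data.Empty using (⊥; ⊥-elim)
open import Data.List using (List; []; _∷_; _++_; [_]; _∷ʳ_; map; take; drop; length; upTo; last)
open import Data.List.Properties
open import Data.List.Reverse using (Reverse; []; _∶_∶ʳ_; reverseView)
open import Data.List.Membership.Propositional using (_∈_; _∉_)
open import Data.List.Membership.Propositional.Properties
  using (∈-upTo⁻; ∈-upTo⁺; ∈-∃++; ∈-++⁻; ∈-++⁺ˡ; ∈-++⁺ʳ; ∈-map⁻)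
open import Data.List.Relation.Unary.Any using (here; there)
open import Data.List.Relation.Unary.All as All using (All; []; _∷_)
import Data.List.Relation.Unary.All.Properties as Allₚ
open import Data.List.Relation.Unary.AllPairs using ([]; _∷_)
open import Data.List.Relation.Unary.Unique.Propositional using (Unique)
open import Data.List.Relation.Binary.Pointwise as Pointwise using (Pointwise; []; _∷_)
open import Data.Maybe using (Maybe; just; nothing)
open import Data.Product as Product using (_×_; _,_; proj₁; proj₂; ∃-syntax)
open import Data.Sum as Sum using (_⊎_; inj₁; inj₂)
open import Function using (Equivalence; flip; _∘_)
open import Relation.Binary.PropositionalEquality hiding ([_])
open import Relation.Nullary using (¬_; yes; no)
open import Relation.Nullary.Decidable using (T?)

length-∷ʳ : ∀ {A : Set} (xs : List A) {c} → length (xs ∷ʳ c) ≡ suc (length xs)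
length-∷ʳ []       = refl
length-∷ʳ (_ ∷ xs) = cong suc (length-∷ʳ xs)

length-∷ʳ-injective : ∀ {A : Set} (xs ys : List A) {c c'} → length (xs ∷ʳ c) ≡ length (ys ∷ʳ c') →
                      length xs ≡ length ys
length-∷ʳ-injective xs ys e = suc-injective (trans (sym (length-∷ʳ xs)) (trans e (length-∷ʳ ys)))

∷ʳ-length≢0 : ∀ {A : Set} (xs : List A) {c} → 0 ≢ length (xs ∷ʳ c)
∷ʳ-length≢0 xs e = 0≢1+n (trans e (length-∷ʳ xs))

last-∷ʳ : ∀ {A : Set} (xs : List A) c → last (xs ∷ʳ c) ≡ just c
last-∷ʳ []           c = refl
last-∷ʳ (_ ∷ [])     c = refl
last-∷ʳ (_ ∷ y ∷ xs) c = last-∷ʳ (y ∷ xs) c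

take-++-≤ : ∀ {A : Set} n (xs : List A) {ys} → n ≤ length xs → take n (xs ++ ys) ≡ take n xs
take-++-≤ zero    xs       _         = refl
take-++-≤ (suc n) (x ∷ xs) (s≤s n≤) = cong (x ∷_) (take-++-≤ n xs n≤)

take-length-++ : ∀ {A : Set} (xs : List A) {ys} → take (length xs) (xs ++ ys) ≡ xs
take-length-++ []       = refl
take-length-++ (x ∷ xs) = cong (x ∷_) (take-length-++ xs)

drop-suc-∷ : ∀ {A : Set} k {xs : List A} {y ys} → drop k xs ≡ y ∷ ys → drop (suc k) xs ≡ ys
drop-suc-∷ zero    refl = refl
drop-suc-∷ (suc k) {_ ∷ _} d = drop-suc-∷ k d

-- Junk value 0 past the end of the list.
at : List ℕ → ℕ → ℕ
at []       _       = 0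
at (x ∷ _)  zero    = x
at (_ ∷ xs) (suc d) = at xs d

at-length-++ : ∀ P {z R} → at (P ++ z ∷ R) (length P) ≡ z
at-length-++ []      = refl
at-length-++ (_ ∷ P) = at-length-++ P

first-occurrence-unique : ∀ {P P' : List ℕ} {z R R'} → P ++ z ∷ R ≡ P' ++ z ∷ R' → z ∉ P → z ∉ P' → P ≡ P'
first-occurrence-unique {[]}    {[]}     _ _   _    = refl
first-occurrence-unique {[]}    {_ ∷ _}  refl _ z∉P' = ⊥-elim (z∉P' (here refl))
first-occurrence-unique {_ ∷ _} {[]}     refl z∉P _ = ⊥-elim (z∉P (here refl))
first-occurrence-unique {x ∷ P} {_ ∷ P'} e z∉P z∉P' with ∷-injective e
... | refl , e′ = cong (x ∷_) (first-occurrence-unique e′ (z∉P ∘ there) (z∉P' ∘ there))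

split-at : ∀ {A : Set} d (D : List A) → d < length D → ∃[ P ] ∃[ z ] ∃[ R ] (D ≡ P ++ z ∷ R × length P ≡ d)
split-at zero    (z ∷ R) _         = [] , z , R , refl , refl
split-at (suc d) (x ∷ D) (s≤s d<) with split-at d D d<
... | P , z , R , refl , refl = x ∷ P , z , R , refl , refl

drop-∷ : ∀ {A : Set} k (xs : List A) → k < length xs → ∃[ x ] drop k xs ≡ x ∷ drop (suc k) xs
drop-∷ zero    (x ∷ _)  _         = x , refl
drop-∷ (suc k) (_ ∷ xs) (s≤s k<) = drop-∷ k xs k<

drop≡∷⇒< : ∀ {A : Set} k {xs : List A} {y ys} → drop k xs ≡ y ∷ ys → k < length xs
drop≡∷⇒< zero    {_ ∷ _} _ = s≤s z≤n
drop≡∷⇒< (suc k) {_ ∷ _} d = s≤s (drop≡∷⇒< k d)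

⊑-length≤ : ∀ {u v} → u ⊑ v → length u ≤ length v
⊑-length≤ {u} (t , refl) = ≤-trans (m≤m+n (length u) (length t)) (≤-reflexive (sym (length-++ u)))

⊑-length≡ : ∀ {u v x} → u ⊑ x → v ⊑ x → length u ≡ length v → u ≡ v
⊑-length≡ {u} {v} (t , refl) (t' , e) len = begin
  u                                ≡⟨ take-length-++ u ⟨
  take (length u) (u ++ t)         ≡⟨ cong₂ take len (sym e) ⟩
  take (length v) (v ++ t')        ≡⟨ take-length-++ v ⟩
  v                                ∎
  where open ≡-Reasoning

⊑-trans : ∀ {x y z} → x ⊑ y → y ⊑ z → x ⊑ z
⊑-trans {x} (t , refl) (t' , refl) = t ++ t' , sym (++-assoc x t t')

⊑-++ : ∀ {x y s} → x ⊑ y → x ⊑ (y ++ s)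
⊑-++ {x} {y} {s} (t , e) = t ++ s , trans (sym (++-assoc x t s)) (cong (_++ s) e)

∷ʳ-⊑-∷ʳ : ∀ {u v a b} → (u ∷ʳ a) ⊑ (v ∷ʳ b) → (u ∷ʳ a) ⊑ v ⊎ (u ≡ v × a ≡ b)
∷ʳ-⊑-∷ʳ {u} {v} {a} (t , e) with reverseView t
... | [] = inj₂ (∷ʳ-injective u v (trans (sym (++-identityʳ (u ∷ʳ a))) e))
... | t′ ∶ _ ∶ʳ x = inj₁ (t′ , proj₁ (∷ʳ-injective _ v (trans (++-assoc (u ∷ʳ a) t′ [ x ]) e)))

Unique-map-on : ∀ {A B : Set} {P : A → Set} (f : A → B) → (∀ {x y} → P x → P y → f x ≡ f y → x ≡ y) →
                ∀ {xs} → Unique xs → All P xs → Unique (map f xs)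
Unique-map-on f inj []            []          = []
Unique-map-on f inj (x∉xs ∷ uxs) (px ∷ pxs) =
  Allₚ.map⁺ (All.zipWith (λ (x≢y , py) fx≡fy → x≢y (inj px py fx≡fy)) (x∉xs , pxs)) ∷ Unique-map-on f inj uxs pxs

Unique-⊆⇒length≤ : ∀ {A : Set} {xs ys : List A} → Unique xs → (∀ {x} → x ∈ xs → x ∈ ys) → length xs ≤ length ys
Unique-⊆⇒length≤ [] _ = z≤n
Unique-⊆⇒length≤ {xs = x ∷ xs} (x∉xs ∷ uxs) sub with ∈-∃++ (sub (here refl))
... | ys₁ , ys₂ , refl = begin
  suc (length xs)            ≤⟨ s≤s (Unique-⊆⇒length≤ uxs sub′) ⟩
  suc (length (ys₁ ++ ys₂))  ≡⟨ length-++-sucʳ ys₁ x ys₂ ⟨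
  length (ys₁ ++ x ∷ ys₂)    ∎
  where
  open ≤-Reasoning
  sub′ : ∀ {y} → y ∈ xs → y ∈ ys₁ ++ ys₂
  sub′ {y} y∈xs with ∈-++⁻ ys₁ (sub (there y∈xs))
  ... | inj₁ y∈ys₁         = ∈-++⁺ˡ y∈ys₁
  ... | inj₂ (here y≡x)    = ⊥-elim (All.lookup x∉xs y∈xs (sym y≡x))
  ... | inj₂ (there y∈ys₂) = ∈-++⁺ʳ ys₁ y∈ys₂

Unique⇒length≤ : ∀ {A : Set} {P : A → Set} (f : A → ℕ) {σ} →
                 (∀ {x y} → P x → P y → f x ≡ f y → x ≡ y) → (∀ {x} → P x → f x < σ) →
                 ∀ {xs} → Unique xs → All P xs → length xs ≤ σ
Unique⇒length≤ f {σ} inj bound {xs} uxs pxs = begin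
  length xs          ≡⟨ length-map f xs ⟨
  length (map f xs)  ≤⟨ Unique-⊆⇒length≤ (Unique-map-on f inj uxs pxs) in-range ⟩
  length (upTo σ)    ≡⟨ length-upTo σ ⟩
  σ                  ∎
  where
  open ≤-Reasoning
  in-range : ∀ {y} → y ∈ map f xs → y ∈ upTo σ
  in-range y∈ with ∈-map⁻ f y∈
  ... | x , x∈xs , refl = ∈-upTo⁺ (bound (All.lookup pxs x∈xs))

-- Order-isomorphism

data Aligned : List ℕ → List ℕ → ℕ → ℕ → Set where
  here  : ∀ {p q xs ys} → Aligned (p ∷ xs) (q ∷ ys) p q
  there : ∀ {x y xs ys p q} → Aligned xs ys p q → Aligned (x ∷ xs) (y ∷ ys) p q

Aligned-swap : ∀ {xs ys p q} → Aligned xs ys p q → Aligned ys xs q p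
Aligned-swap here      = here
Aligned-swap (there a) = there (Aligned-swap a)

Aligned⇒∈ : ∀ {xs ys p q} → Aligned xs ys p q → p ∈ xs
Aligned⇒∈ here      = here refl
Aligned⇒∈ (there a) = there (Aligned⇒∈ a)

∈⇒Aligned : ∀ {xs ys p} → length xs ≡ length ys → p ∈ xs → ∃[ q ] Aligned xs ys p q
∈⇒Aligned {_ ∷ _} {_ ∷ _} _ (here refl) = _ , here
∈⇒Aligned {_ ∷ _} {_ ∷ _} e (there p∈) = Product.map₂ there (∈⇒Aligned (suc-injective e) p∈)

Aligned-++ˡ : ∀ {xs ys as bs p q} → Aligned xs ys p q → Aligned (xs ++ as) (ys ++ bs) p q
Aligned-++ˡ here      = here
Aligned-++ˡ (there a) = there (Aligned-++ˡ a)

Aligned-∷ʳ-last : ∀ {xs ys c c'} → length xs ≡ length ys → Aligned (xs ∷ʳ c) (ys ∷ʳ c') c c'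
Aligned-∷ʳ-last {[]}    {[]}    _ = here
Aligned-∷ʳ-last {_ ∷ _} {_ ∷ _} e = there (Aligned-∷ʳ-last (suc-injective e))

Aligned-∷ʳ⁻ : ∀ {xs ys c c' p q} → length xs ≡ length ys → Aligned (xs ∷ʳ c) (ys ∷ʳ c') p q →
              Aligned xs ys p q ⊎ (p ≡ c × q ≡ c')
Aligned-∷ʳ⁻ {[]}    {[]}    _ here      = inj₂ (refl , refl)
Aligned-∷ʳ⁻ {_ ∷ _} {_ ∷ _} _ here      = inj₁ here
Aligned-∷ʳ⁻ {_ ∷ _} {_ ∷ _} e (there a) = Sum.map₁ there (Aligned-∷ʳ⁻ (suc-injective e) a)

Aligned-drop : ∀ j {xs ys p q as bs} → drop j xs ≡ p ∷ as → drop j ys ≡ q ∷ bs → Aligned xs ys p q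
Aligned-drop zero    refl refl = here
Aligned-drop (suc j) {_ ∷ _} {_ ∷ _} dx dy = there (Aligned-drop j dx dy)

Aligned-pointwise : ∀ {xs ys} → length xs ≡ length ys → Pointwise (Aligned xs ys) xs ys
Aligned-pointwise {[]}    {[]}    _ = []
Aligned-pointwise {_ ∷ _} {_ ∷ _} e = here ∷ Pointwise.map there (Aligned-pointwise (suc-injective e))

-- The paper's x ≈ y ("x[i] ≤ x[j] iff y[i] ≤ y[j]"), quantifying over pairs of letters at a common index.
infix 4 _≈_

record _≈_ (xs ys : List ℕ) : Set where
  field
    length≡      : length xs ≡ length ys
    ≤ᵇ-coherent : ∀ {p p' q q'} → Aligned xs ys p p' → Aligned xs ys q q' → (p ≤ᵇ q) ≡ (p' ≤ᵇ q')

open _≈_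

≤ᵇ-refl : ∀ m → (m ≤ᵇ m) ≡ true
≤ᵇ-refl m = Equivalence.to T-≡ (≤⇒≤ᵇ (≤-refl {m}))

≤ᵇ-transfer : ∀ {p q p' q'} → (p ≤ᵇ q) ≡ (p' ≤ᵇ q') → p ≤ q → p' ≤ q'
≤ᵇ-transfer e p≤q = ≤ᵇ⇒≤ _ _ (subst T e (≤⇒≤ᵇ p≤q))

≈-sym : ∀ {xs ys} → xs ≈ ys → ys ≈ xs
≈-sym e = record
  { length≡     = sym (length≡ e)
  ; ≤ᵇ-coherent = λ a b → sym (≤ᵇ-coherent e (Aligned-swap a) (Aligned-swap b))
  }

≈-fromAligned : ∀ {xs₀ ys₀ xs ys} → xs₀ ≈ ys₀ → length xs ≡ length ys →
                (∀ {p q} → Aligned xs ys p q → Aligned xs₀ ys₀ p q) → xs ≈ ys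
≈-fromAligned e len sub = record { length≡ = len ; ≤ᵇ-coherent = λ a b → ≤ᵇ-coherent e (sub a) (sub b) }

≈-∷⁻ : ∀ {x y xs ys} → x ∷ xs ≈ y ∷ ys → xs ≈ ys
≈-∷⁻ e = ≈-fromAligned e (suc-injective (length≡ e)) there

≈-∷ʳ⁻ : ∀ {xs ys c c'} → xs ∷ʳ c ≈ ys ∷ʳ c' → xs ≈ ys
≈-∷ʳ⁻ {xs} {ys} e = ≈-fromAligned e (length-∷ʳ-injective xs ys (length≡ e)) Aligned-++ˡ

≈-∷ʳ : ∀ {xs ys c c'} → xs ≈ ys →
       (∀ {q q'} → Aligned xs ys q q' → (q ≤ᵇ c) ≡ (q' ≤ᵇ c') × (c ≤ᵇ q) ≡ (c' ≤ᵇ q')) →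
       xs ∷ʳ c ≈ ys ∷ʳ c'
≈-∷ʳ {xs} {ys} {c} {c'} e last-coherent = record
  { length≡     = trans (length-∷ʳ xs) (trans (cong suc (length≡ e)) (sym (length-∷ʳ ys)))
  ; ≤ᵇ-coherent = coherent
  }
  where
  coherent : ∀ {p p' q q'} → Aligned (xs ∷ʳ c) (ys ∷ʳ c') p p' → Aligned (xs ∷ʳ c) (ys ∷ʳ c') q q' →
             (p ≤ᵇ q) ≡ (p' ≤ᵇ q')
  coherent a b with Aligned-∷ʳ⁻ (length≡ e) a | Aligned-∷ʳ⁻ (length≡ e) b
  ... | inj₁ a' | inj₁ b'               = ≤ᵇ-coherent e a' b'
  ... | inj₁ a' | inj₂ (refl , refl)    = proj₁ (last-coherent a')
  ... | inj₂ (refl , refl) | inj₁ b'    = proj₂ (last-coherent b')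
  ... | inj₂ (refl , refl) | inj₂ (refl , refl) = trans (≤ᵇ-refl c) (sym (≤ᵇ-refl c'))

≈-partner-≡ : ∀ {xs ys p p' q q'} → xs ≈ ys → Aligned xs ys p p' → Aligned xs ys q q' → p ≡ q → p' ≡ q'
≈-partner-≡ {p = p} e a b refl = ≤-antisym (≤ᵇ-transfer (≤ᵇ-coherent e a b) (≤-refl {p}))
                                            (≤ᵇ-transfer (≤ᵇ-coherent e b a) (≤-refl {p}))

-- Every aligned pair already occurs in yQ, y'Q': z is a letter of Q, and its partner there is z'
-- because equal letters have equal partners in Qz ≈ Q'z'.
≈-∷-∷ʳ : ∀ {y y' Q Q' z z'} → y ∷ Q ≈ y' ∷ Q' → Q ∷ʳ z ≈ Q' ∷ʳ z' → z ∈ Q →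
         y ∷ (Q ∷ʳ z) ≈ y' ∷ (Q' ∷ʳ z')
≈-∷-∷ʳ {y} {y'} {Q} {Q'} {z} {z'} head-iso last-iso z∈Q =
  ≈-fromAligned head-iso (cong suc (length≡ last-iso)) into-head
  where
  lenQ = suc-injective (length≡ head-iso)
  partner = ∈⇒Aligned lenQ z∈Q
  partner≡z' : proj₁ partner ≡ z'
  partner≡z' = ≈-partner-≡ last-iso (Aligned-++ˡ (proj₂ partner)) (Aligned-∷ʳ-last lenQ) refl
  into-head : ∀ {p q} → Aligned (y ∷ (Q ∷ʳ z)) (y' ∷ (Q' ∷ʳ z')) p q → Aligned (y ∷ Q) (y' ∷ Q') p q
  into-head here = here
  into-head (there a) with Aligned-∷ʳ⁻ lenQ a
  ... | inj₁ a'            = there a'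
  ... | inj₂ (refl , refl) = there (subst (Aligned Q Q' z) partner≡z' (proj₂ partner))

≈-∷ʳ-∈ : ∀ {Q P z z'} → Q ∷ʳ z ≈ P ∷ʳ z' → z' ∈ P → z ∈ Q
≈-∷ʳ-∈ {Q} {P} {z} {z'} e z'∈P = subst (_∈ Q) partner≡z (Aligned⇒∈ (Aligned-swap (proj₂ partner)))
  where
  e' = ≈-sym e
  lenP = length-∷ʳ-injective P Q (length≡ e')
  partner = ∈⇒Aligned lenP z'∈P
  partner≡z : proj₁ partner ≡ z
  partner≡z = ≈-partner-≡ e' (Aligned-++ˡ (proj₂ partner)) (Aligned-∷ʳ-last lenP) refl

T-injective : ∀ {a b} → (T a → T b) → (T b → T a) → a ≡ b
T-injective {false} {false} _ _ = refl
T-injective {false} {true}  _ g = ⊥-elim (g tt)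
T-injective {true}  {false} f _ = ⊥-elim (f tt)
T-injective {true}  {true}  _ _ = refl

-- pGo and sGo are the same left-to-right scan, for the orders ≤ and ≥ respectively.
module Scan (_≼_ : ℕ → ℕ → Bool) where

  scan : ℕ → ℕ → Maybe (ℕ × ℕ) → List ℕ → Maybe (ℕ × ℕ)
  scan c k best [] = best
  scan c k best (y ∷ ys) with y ≼ c | best
  ... | false | _ = scan c (suc k) best ys
  ... | true | nothing = scan c (suc k) (just (k , y)) ys
  ... | true | just (j , b) =
    if b ≼ y then scan c (suc k) (just (k , y)) ys else scan c (suc k) best ys

  data SameIndex (Z : ℕ → ℕ → Set) : Maybe (ℕ × ℕ) → Maybe (ℕ × ℕ) → Set where
    nothing : SameIndex Z nothing nothing
    just    : ∀ {j v v'} → Z v v' → SameIndex Z (just (j , v)) (just (j , v'))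

  SameIndex⇒mfst≡ : ∀ {Z r r'} → SameIndex Z r r' → mfst r ≡ mfst r'
  SameIndex⇒mfst≡ nothing  = refl
  SameIndex⇒mfst≡ (just _) = refl

  module _ {Z : ℕ → ℕ → Set} (coherent : ∀ {p p' q q'} → Z p p' → Z q q' → (p ≼ q) ≡ (p' ≼ q')) where

    scan-SameIndex : ∀ {c c'} → Z c c' → ∀ k {ys ys' best best'} → Pointwise Z ys ys' →
                     SameIndex Z best best' → SameIndex Z (scan c k best ys) (scan c' k best' ys')
    scan-SameIndex zc k [] s = s
    scan-SameIndex {c} {c'} zc k (_∷_ {y} {y'} zy zs) s with y ≼ c | y' ≼ c' | coherent zy zc
    ... | false | .false | refl = scan-SameIndex zc (suc k) zs s
    scan-SameIndex zc k (zy ∷ zs) nothing | true | .true | refl = scan-SameIndex zc (suc k) zs (just zy)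
    scan-SameIndex zc k (_∷_ {y} {y'} zy zs) (just {v = b} {b'} zb) | true | .true | refl
      with b ≼ y | b' ≼ y' | coherent zb zy
    ... | true  | .true  | refl = scan-SameIndex zc (suc k) zs (just zy)
    ... | false | .false | refl = scan-SameIndex zc (suc k) zs (just zb)

    scan-cong : ∀ {c c' ys ys'} → Z c c' → Pointwise Z ys ys' →
                mfst (scan c 0 nothing ys) ≡ mfst (scan c' 0 nothing ys')
    scan-cong zc zs = SameIndex⇒mfst≡ (scan-SameIndex zc 0 zs nothing)

  module Spec (≼-trans : ∀ {a b c} → T (a ≼ b) → T (b ≼ c) → T (a ≼ c))
              (≼-total : ∀ {a b} → ¬ T (a ≼ b) → T (b ≼ a)) where

    ≼-refl : ∀ {a} → T (a ≼ a)
    ≼-refl {a} with T? (a ≼ a)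
    ... | yes t = t
    ... | no ¬t = ≼-total ¬t

    data Outcome (c : ℕ) (xs : List ℕ) : Maybe (ℕ × ℕ) → Set where
      none : (∀ {q} → q ∈ xs → ¬ T (q ≼ c)) → Outcome c xs nothing
      found : ∀ {j v rest} → drop j xs ≡ v ∷ rest → T (v ≼ c) →
             (∀ {q} → q ∈ xs → T (q ≼ c) → T (q ≼ v)) → Outcome c xs (just (j , v))

    Candidate : ℕ → List ℕ → Maybe (ℕ × ℕ) → Set
    Candidate c xs nothing        = ⊤
    Candidate c xs (just (j , v)) = T (v ≼ c) × ∃[ rest ] drop j xs ≡ v ∷ rest

    Dominates : ℕ → Maybe (ℕ × ℕ) → Set
    Dominates q nothing        = ⊥
    Dominates q (just (_ , v)) = T (q ≼ v)

    scan-Candidate : ∀ {xs} c k best ys → drop k xs ≡ ys → Candidate c xs best →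
                     Candidate c xs (scan c k best ys)
    scan-Candidate c k best [] _ cand = cand
    scan-Candidate c k best (y ∷ ys) d cand with y ≼ c in y≼c | best
    ... | false | _       = scan-Candidate c (suc k) _ ys (drop-suc-∷ k d) cand
    ... | true  | nothing = scan-Candidate c (suc k) _ ys (drop-suc-∷ k d) (subst T (sym y≼c) tt , _ , d)
    ... | true  | just (_ , b) with b ≼ y
    ...   | true  = scan-Candidate c (suc k) _ ys (drop-suc-∷ k d) (subst T (sym y≼c) tt , _ , d)
    ...   | false = scan-Candidate c (suc k) _ ys (drop-suc-∷ k d) cand

    private
      advance : ∀ {A B : Set} {q y : ℕ} {ys} → q ∈ y ∷ ys ⊎ A → (q ≡ y → B) → (A → B) → q ∈ ys ⊎ B
      advance (inj₁ (here q≡y)) f _ = inj₂ (f q≡y)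
      advance (inj₁ (there q∈)) _ _ = inj₁ q∈
      advance (inj₂ a)          _ g = inj₂ (g a)

    scan-Dominates : ∀ q c k best ys → T (q ≼ c) → q ∈ ys ⊎ Dominates q best → Dominates q (scan c k best ys)
    scan-Dominates q c k best [] _ (inj₂ dom) = dom
    scan-Dominates q c k best (y ∷ ys) q≼c h with y ≼ c in y≼c | best
    ... | false | _ = scan-Dominates q c (suc k) _ ys q≼c
                        (advance h (λ { refl → ⊥-elim (subst T y≼c q≼c) }) (λ dom → dom))
    ... | true | nothing = scan-Dominates q c (suc k) _ ys q≼c (advance h (λ { refl → ≼-refl }) λ ())
    ... | true | just (_ , b) with b ≼ y in b≼y
    ...   | true  = scan-Dominates q c (suc k) _ ys q≼c
                      (advance h (λ { refl → ≼-refl }) (λ q≼b → ≼-trans q≼b (subst T (sym b≼y) tt)))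
    ...   | false = scan-Dominates q c (suc k) _ ys q≼c
                      (advance h (λ { refl → ≼-total (subst T b≼y) }) (λ dom → dom))

    scan-outcome : ∀ c xs → Outcome c xs (scan c 0 nothing xs)
    scan-outcome c xs with scan c 0 nothing xs | scan-Candidate {xs} c 0 nothing xs refl tt
                         | (λ q q≼c → scan-Dominates q c 0 nothing xs q≼c)
    ... | nothing      | _              | dom = none λ q∈ q≼c → dom _ q≼c (inj₁ q∈)
    ... | just (_ , v) | v≼c , _ , d    | dom = found d v≼c λ q∈ q≼c → dom _ q≼c (inj₁ q∈)

    -- The maximum v found below c splits the letters as c does: q ≼ c iff q ≼ v.
    scan-decides : ∀ {xs ys c c' q q'} → length xs ≡ length ys →
                   (∀ {p p' r r'} → Aligned xs ys p p' → Aligned xs ys r r' → (p ≼ r) ≡ (p' ≼ r')) →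
                   mfst (scan c 0 nothing xs) ≡ mfst (scan c' 0 nothing ys) →
                   Aligned xs ys q q' → (q ≼ c) ≡ (q' ≼ c')
    scan-decides {xs} {ys} {c} {c'} {q} {q'} len coherent same a
      with scan c 0 nothing xs | scan-outcome c xs | scan c' 0 nothing ys | scan-outcome c' ys
    ... | nothing | none ¬x | nothing | none ¬y =
      T-injective (λ t → ⊥-elim (¬x (Aligned⇒∈ a) t)) (λ t → ⊥-elim (¬y (Aligned⇒∈ (Aligned-swap a)) t))
    ... | just (j , v) | found dx v≼c maxˣ | just (j' , v') | found dy v'≼c' maxʸ with same
    ...   | refl = begin
      q ≼ c    ≡⟨ T-injective (maxˣ (Aligned⇒∈ a)) (λ q≼v → ≼-trans q≼v v≼c) ⟩
      q ≼ v    ≡⟨ coherent a (Aligned-drop j dx dy) ⟩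
      q' ≼ v'  ≡⟨ T-injective (λ q'≼v' → ≼-trans q'≼v' v'≼c') (maxʸ (Aligned⇒∈ (Aligned-swap a))) ⟩
      q' ≼ c'  ∎
      where open ≡-Reasoning

≤ᵇ-trans : ∀ {a b c} → T (a ≤ᵇ b) → T (b ≤ᵇ c) → T (a ≤ᵇ c)
≤ᵇ-trans {a} {b} {c} ab bc = ≤⇒≤ᵇ (≤-trans (≤ᵇ⇒≤ a b ab) (≤ᵇ⇒≤ b c bc))

≤ᵇ-total : ∀ {a b} → ¬ T (a ≤ᵇ b) → T (b ≤ᵇ a)
≤ᵇ-total {a} {b} a≰b = ≤⇒≤ᵇ (<⇒≤ (≰⇒> {a} {b} (λ a≤b → a≰b (≤⇒≤ᵇ a≤b))))

module Below = Scan _≤ᵇ_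
module Above = Scan (flip _≤ᵇ_)
module BelowSpec = Below.Spec (λ {a} {b} {c} → ≤ᵇ-trans {a} {b} {c}) (λ {a} {b} → ≤ᵇ-total {a} {b})
module AboveSpec = Above.Spec (λ {a} {b} {c} ab bc → ≤ᵇ-trans {c} {b} {a} bc ab) (λ {a} {b} → ≤ᵇ-total {b} {a})

pGo≡scan : ∀ c k best ys → pGo c k best ys ≡ Below.scan c k best ys
pGo≡scan c k best [] = refl
pGo≡scan c k best (y ∷ ys) with y ≤ᵇ c | best
... | false | _ = pGo≡scan c (suc k) _ ys
... | true | nothing = pGo≡scan c (suc k) _ ys
... | true | just (j , b) with b ≤ᵇ y
...   | true  = pGo≡scan c (suc k) _ ys
...   | false = pGo≡scan c (suc k) _ ys

sGo≡scan : ∀ c k best ys → sGo c k best ys ≡ Above.scan c k best ys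
sGo≡scan c k best [] = refl
sGo≡scan c k best (y ∷ ys) with c ≤ᵇ y | best
... | false | _ = sGo≡scan c (suc k) _ ys
... | true | nothing = sGo≡scan c (suc k) _ ys
... | true | just (j , b) with y ≤ᵇ b
...   | true  = sGo≡scan c (suc k) _ ys
...   | false = sGo≡scan c (suc k) _ ys

-- PrefCode characterises ≈

lastCode-∷ʳ : ∀ xs c → lastCode (xs ∷ʳ c) ≡ (mfst (Below.scan c 0 nothing xs) , mfst (Above.scan c 0 nothing xs))
lastCode-∷ʳ xs c with last (xs ∷ʳ c) | last-∷ʳ xs c
... | .(just c) | refl = cong₂ _,_ (cong mfst (trans (cong (pGo c 0 nothing) init≡xs) (pGo≡scan c 0 nothing xs)))
                                   (cong mfst (trans (cong (sGo c 0 nothing) init≡xs) (sGo≡scan c 0 nothing xs)))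
  where
  init≡xs : take (length (xs ∷ʳ c) ∸ 1) (xs ∷ʳ c) ≡ xs
  init≡xs = trans (cong (λ m → take (m ∸ 1) (xs ∷ʳ c)) (length-∷ʳ xs)) (take-length-++ xs)

length-prefCode : ∀ xs → length (prefCode xs) ≡ length xs
length-prefCode xs = trans (length-map _ (upTo (length xs))) (length-upTo (length xs))

prefCode-∷ʳ : ∀ xs c → prefCode (xs ∷ʳ c) ≡ prefCode xs ∷ʳ lastCode (xs ∷ʳ c)
prefCode-∷ʳ xs c = begin
  map f (upTo (length (xs ∷ʳ c)))      ≡⟨ cong (map f ∘ upTo) (length-∷ʳ xs) ⟩
  map f (upTo (suc m))                 ≡⟨ cong (map f) (upTo-∷ʳ m) ⟨
  map f (upTo m ∷ʳ m)                  ≡⟨ map-++ f (upTo m) [ m ] ⟩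
  map f (upTo m) ∷ʳ f m                ≡⟨ cong₂ _∷ʳ_ (map-cong-local (All.tabulate on-prefix)) on-last ⟩
  prefCode xs ∷ʳ lastCode (xs ∷ʳ c)    ∎
  where
  open ≡-Reasoning
  m = length xs
  f : ℕ → Code
  f k = lastCode (take (suc k) (xs ∷ʳ c))
  on-prefix : ∀ {k} → k ∈ upTo m → f k ≡ lastCode (take (suc k) xs)
  on-prefix k∈ = cong lastCode (take-++-≤ _ xs (∈-upTo⁻ k∈))
  on-last : f m ≡ lastCode (xs ∷ʳ c)
  on-last = cong lastCode (take-all (suc m) (xs ∷ʳ c) (≤-reflexive (length-∷ʳ xs)))

prefCode-++ : ∀ xs ys → ∃[ r ] prefCode (xs ++ ys) ≡ prefCode xs ++ r
prefCode-++ xs ys = go (reverseView ys)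
  where
  go : ∀ {ys} → Reverse ys → ∃[ r ] prefCode (xs ++ ys) ≡ prefCode xs ++ r
  go [] = [] , trans (cong prefCode (++-identityʳ xs)) (sym (++-identityʳ _))
  go (ys ∶ rys ∶ʳ c) with go rys
  ... | r , e = r ∷ʳ lastCode ((xs ++ ys) ∷ʳ c) , (begin
    prefCode (xs ++ ys ∷ʳ c)                            ≡⟨ cong prefCode (++-assoc xs ys [ c ]) ⟨
    prefCode ((xs ++ ys) ∷ʳ c)                          ≡⟨ prefCode-∷ʳ (xs ++ ys) c ⟩
    prefCode (xs ++ ys) ∷ʳ lastCode ((xs ++ ys) ∷ʳ c)   ≡⟨ cong (_∷ʳ lastCode ((xs ++ ys) ∷ʳ c)) e ⟩
    (prefCode xs ++ r) ∷ʳ lastCode ((xs ++ ys) ∷ʳ c)    ≡⟨ ++-assoc (prefCode xs) r _ ⟩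
    prefCode xs ++ r ∷ʳ lastCode ((xs ++ ys) ∷ʳ c)      ∎)
    where open ≡-Reasoning

lastCode-cong : ∀ {xs ys c c'} → xs ∷ʳ c ≈ ys ∷ʳ c' → lastCode (xs ∷ʳ c) ≡ lastCode (ys ∷ʳ c')
lastCode-cong {xs} {ys} {c} {c'} e = begin
  lastCode (xs ∷ʳ c)                                                          ≡⟨ lastCode-∷ʳ xs c ⟩
  (mfst (Below.scan c 0 nothing xs) , mfst (Above.scan c 0 nothing xs))      ≡⟨ cong₂ _,_
      (Below.scan-cong (≤ᵇ-coherent e) last-aligned init-aligned)
      (Above.scan-cong (λ a b → ≤ᵇ-coherent e b a) last-aligned init-aligned) ⟩
  (mfst (Below.scan c' 0 nothing ys) , mfst (Above.scan c' 0 nothing ys))    ≡⟨ lastCode-∷ʳ ys c' ⟨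
  lastCode (ys ∷ʳ c')                                                         ∎
  where
  open ≡-Reasoning
  len = length-∷ʳ-injective xs ys (length≡ e)
  last-aligned : Aligned (xs ∷ʳ c) (ys ∷ʳ c') c c'
  last-aligned = Aligned-∷ʳ-last len
  init-aligned : Pointwise (Aligned (xs ∷ʳ c) (ys ∷ʳ c')) xs ys
  init-aligned = Pointwise.map Aligned-++ˡ (Aligned-pointwise len)

lastCode-reflects-≈ : ∀ {xs ys c c'} → xs ≈ ys → lastCode (xs ∷ʳ c) ≡ lastCode (ys ∷ʳ c') → xs ∷ʳ c ≈ ys ∷ʳ c'
lastCode-reflects-≈ {xs} {ys} {c} {c'} e same = ≈-∷ʳ e λ a →
    BelowSpec.scan-decides (length≡ e) (≤ᵇ-coherent e) (cong proj₁ same′) a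
  , AboveSpec.scan-decides (length≡ e) (λ p r → ≤ᵇ-coherent e r p) (cong proj₂ same′) a
  where
  same′ = trans (sym (lastCode-∷ʳ xs c)) (trans same (lastCode-∷ʳ ys c'))

≈⇒prefCode≡ : ∀ {xs ys} → xs ≈ ys → prefCode xs ≡ prefCode ys
≈⇒prefCode≡ = go (reverseView _) (reverseView _)
  where
  go : ∀ {xs ys} → Reverse xs → Reverse ys → xs ≈ ys → prefCode xs ≡ prefCode ys
  go [] [] _ = refl
  go [] (ys ∶ _ ∶ʳ _) e = ⊥-elim (∷ʳ-length≢0 ys (length≡ e))
  go (xs ∶ _ ∶ʳ _) [] e = ⊥-elim (∷ʳ-length≢0 xs (sym (length≡ e)))
  go (xs ∶ rxs ∶ʳ c) (ys ∶ rys ∶ʳ c') e = begin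
    prefCode (xs ∷ʳ c)                   ≡⟨ prefCode-∷ʳ xs c ⟩
    prefCode xs ∷ʳ lastCode (xs ∷ʳ c)    ≡⟨ cong₂ _∷ʳ_ (go rxs rys (≈-∷ʳ⁻ e)) (lastCode-cong e) ⟩
    prefCode ys ∷ʳ lastCode (ys ∷ʳ c')   ≡⟨ prefCode-∷ʳ ys c' ⟨
    prefCode (ys ∷ʳ c')                  ∎
    where open ≡-Reasoning

prefCode≡⇒≈ : ∀ {xs ys} → prefCode xs ≡ prefCode ys → xs ≈ ys
prefCode≡⇒≈ = go (reverseView _) (reverseView _)
  where
  go : ∀ {xs ys} → Reverse xs → Reverse ys → prefCode xs ≡ prefCode ys → xs ≈ ys
  go [] [] _ = record { length≡ = refl ; ≤ᵇ-coherent = λ () }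
  go [] (ys ∶ _ ∶ʳ _) e = ⊥-elim (∷ʳ-length≢0 ys (trans (cong length e) (length-prefCode (ys ∷ʳ _))))
  go (xs ∶ _ ∶ʳ _) [] e = ⊥-elim (∷ʳ-length≢0 xs (trans (cong length (sym e)) (length-prefCode (xs ∷ʳ _))))
  go (xs ∶ rxs ∶ʳ c) (ys ∶ rys ∶ʳ c') e = lastCode-reflects-≈ (go rxs rys (proj₁ split)) (proj₂ split)
    where
    split = ∷ʳ-injective (prefCode xs) (prefCode ys)
              (trans (sym (prefCode-∷ʳ xs c)) (trans e (prefCode-∷ʳ ys c')))

-- Paths of the trie

-- The symbol that follows PrefCode(P) on the path PrefCode(P ++ R)$.
after : List ℕ → List ℕ → Sym
after P []      = dollar
after P (z ∷ _) = code (lastCode (P ∷ʳ z))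

code-injective : ∀ {a b} → code a ≡ code b → a ≡ b
code-injective refl = refl

dollar≢code : ∀ {a} → dollar ≢ code a
dollar≢code ()

module _ {σ : ℕ} (w : List (Fin σ)) where

  private
    W = wℕ w

  length-codes : ∀ xs → length (codes w xs) ≡ length xs
  length-codes xs = trans (length-map code (prefCode xs)) (length-prefCode xs)

  codes-∷ʳ : ∀ xs z → codes w (xs ∷ʳ z) ≡ codes w xs ∷ʳ code (lastCode (xs ∷ʳ z))
  codes-∷ʳ xs z = trans (cong (map code) (prefCode-∷ʳ xs z)) (map-++ code (prefCode xs) _)

  codes-++ : ∀ xs ys → ∃[ r ] codes w (xs ++ ys) ≡ codes w xs ++ r
  codes-++ xs ys with prefCode-++ xs ys
  ... | r , e = map code r , trans (cong (map code) e) (map-++ code (prefCode xs) r)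

  codes≡⇒≈ : ∀ {xs ys} → codes w xs ≡ codes w ys → xs ≈ ys
  codes≡⇒≈ e = prefCode≡⇒≈ (map-injective code-injective e)

  ≈⇒codes≡ : ∀ {xs ys} → xs ≈ ys → codes w xs ≡ codes w ys
  ≈⇒codes≡ e = cong (map code) (≈⇒prefCode≡ e)

  next-code-⊑ : ∀ P z R → (codes w P ∷ʳ code (lastCode (P ∷ʳ z))) ⊑ codes w (P ++ z ∷ R)
  next-code-⊑ P z R with codes-++ (P ∷ʳ z) R
  ... | r , e = r , (begin
    (codes w P ∷ʳ code (lastCode (P ∷ʳ z))) ++ r  ≡⟨ cong (_++ r) (codes-∷ʳ P z) ⟨
    codes w (P ∷ʳ z) ++ r                         ≡⟨ e ⟨
    codes w (P ∷ʳ z ++ R)                         ≡⟨ cong (codes w) (∷ʳ-++ P z R) ⟩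
    codes w (P ++ z ∷ R)                          ∎)
    where open ≡-Reasoning

  after-⊑ : ∀ P R → (codes w P ++ [ after P R ]) ⊑ (codes w (P ++ R) ++ [ dollar ])
  after-⊑ P []      = [] , trans (++-identityʳ _) (cong (λ x → codes w x ++ [ dollar ]) (sym (++-identityʳ P)))
  after-⊑ P (z ∷ R) = ⊑-++ (next-code-⊑ P z R)

  ⊑-after : ∀ {u a} D → (u ++ [ a ]) ⊑ (codes w D ++ [ dollar ]) →
            ∃[ P ] ∃[ R ] (D ≡ P ++ R × u ≡ codes w P × a ≡ after P R)
  ⊑-after {u} {a} D u∷a⊑ with ∷ʳ-⊑-∷ʳ u∷a⊑
  ... | inj₂ (u≡ , a≡) = D , [] , sym (++-identityʳ D) , u≡ , a≡
  ... | inj₁ u∷a⊑codes with split-at (length u) D |u|<|D|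
    where
    |u|<|D| : length u < length D
    |u|<|D| = begin-strict
      length u              <⟨ n<1+n (length u) ⟩
      suc (length u)        ≡⟨ length-∷ʳ u ⟨
      length (u ∷ʳ a)       ≤⟨ ⊑-length≤ u∷a⊑codes ⟩
      length (codes w D)    ≡⟨ length-codes D ⟩
      length D              ∎
      where open ≤-Reasoning
  ...   | P , z , R , refl , |P|≡|u| = P , z ∷ R , refl , proj₁ same , proj₂ same
    where
    next = code (lastCode (P ∷ʳ z))
    lengths : length (u ∷ʳ a) ≡ length (codes w P ∷ʳ next)
    lengths = begin
      length (u ∷ʳ a)              ≡⟨ length-∷ʳ u ⟩
      suc (length u)               ≡⟨ cong suc |P|≡|u| ⟨
      suc (length P)               ≡⟨ cong suc (length-codes P) ⟨
      suc (length (codes w P))     ≡⟨ length-∷ʳ (codes w P) ⟨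
      length (codes w P ∷ʳ next)   ∎
      where open ≡-Reasoning
    same = ∷ʳ-injective u (codes w P) (⊑-length≡ u∷a⊑codes (next-code-⊑ P z R) lengths)

  length-W : length W ≡ n w
  length-W = length-map toℕ w

  letters<σ : All (_< σ) W
  letters<σ = Allₚ.map⁺ (All.tabulate (λ {x} _ → toℕ<n x))

  child⇒occurrence : ∀ {u a} → IsNode w (u ++ [ a ]) →
                     ∃[ k ] ∃[ P ] ∃[ R ] (k < n w × drop k W ≡ P ++ R × u ≡ codes w P × a ≡ after P R)
  child⇒occurrence (k , k<n , u∷a⊑) with ⊑-after (drop k W) u∷a⊑
  ... | P , R , D≡ , u≡ , a≡ = k , P , R , k<n , D≡ , u≡ , a≡

  occurrence⇒child : ∀ {k P R} → k < n w → drop k W ≡ P ++ R → IsNode w (codes w P ++ [ after P R ])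
  occurrence⇒child {k} {P} {R} k<n D≡ =
    k , k<n , subst (λ D → (codes w P ++ [ after P R ]) ⊑ (codes w D ++ [ dollar ])) (sym D≡) (after-⊑ P R)

  path-child : ∀ {i u} → i < n w → u ⊑ Seq w i → ¬ IsLeaf w u →
               ∃[ P ] ∃[ R ] (drop i W ≡ P ++ R × u ≡ codes w P × IsNode w (u ++ [ after P R ]))
  path-child {i} {u} i<n ([] , e) ¬leaf = ⊥-elim (¬leaf (i , i<n , trans (sym (++-identityʳ u)) e))
  path-child {i} {u} i<n (a ∷ t , e) _ with ⊑-after (drop i W) (t , trans (++-assoc u [ a ] t) e)
  ... | P , R , D≡ , u≡ , _ =
    P , R , D≡ , u≡ , subst (λ v → IsNode w (v ++ [ after P R ])) (sym u≡) (occurrence⇒child i<n D≡)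

  -- a is read at an occurrence yQ·R of V; one position later the same occurrence reads
  -- after Q R ≡ c below u = PrefCode(Q).
  LinkedChild : List Sym → Sym → List ℕ → Sym → Set
  LinkedChild u c V a = ∃[ y ] ∃[ Q ] ∃[ R ]
    (codes w (y ∷ Q) ≡ codes w V × codes w Q ≡ u × a ≡ after (y ∷ Q) R × after Q R ≡ c)

  -- The shifted child is a node of the trie because Q ≠ [] keeps the shifted suffix nonempty.
  linked-child : ∀ {u c x U a} → (∀ b → IsNode w (u ++ [ b ]) → b ≡ c) → u ≢ [] → u ≡ codes w U →
                 IsNode w (codes w (x ∷ U) ++ [ a ]) → LinkedChild u c (x ∷ U) a
  linked-child {u} {c} {x} {U} only u≢[] u≡ node with child⇒occurrence node
  ... | _ , [] , _ , _ , _ , xU≡ , _ = ⊥-elim (1+n≢0 (trans (sym (length-codes (x ∷ U))) (cong length xU≡)))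
  ... | k , y ∷ Q , R , k<n , D≡ , xU≡ , a≡ =
    y , Q , R , sym xU≡ , Q≡u , a≡ , only _ (next-node Q Q≡u (drop-suc-∷ k D≡))
    where
    Q≡u : codes w Q ≡ u
    Q≡u = trans (≈⇒codes≡ (≈-∷⁻ (codes≡⇒≈ (sym xU≡)))) (sym u≡)
    next-node : ∀ Q → codes w Q ≡ u → drop (suc k) W ≡ Q ++ R → IsNode w (u ++ [ after Q R ])
    next-node []      Q≡u _  = ⊥-elim (u≢[] (sym Q≡u))
    next-node (q ∷ Q) Q≡u D≡ = subst (λ v → IsNode w (v ++ [ after (q ∷ Q) R ])) Q≡u
      (occurrence⇒child {suc k} {q ∷ Q} {R} (subst (suc k <_) length-W (drop≡∷⇒< (suc k) {W} D≡)) D≡)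

  NewLetterChild : List Sym → Sym → Set
  NewLetterChild u c = ∃[ Q ] ∃[ z ] (z ∉ Q × u ∷ʳ c ≡ codes w (Q ∷ʳ z))

  -- If the letter z ending the a-occurrence already occurred in Q, then the two occurrences of the
  -- branching node would stay order-isomorphic one letter further, and a = b.
  two-linked-children⇒NewLetterChild : ∀ {u c V a b} → a ≢ b →
    LinkedChild u c V a → LinkedChild u c V b → NewLetterChild u c
  two-linked-children⇒NewLetterChild a≢b (_ , _ , [] , _ , _ , refl , _) (_ , _ , [] , _ , _ , refl , _) =
    ⊥-elim (a≢b refl)
  two-linked-children⇒NewLetterChild _ (_ , _ , [] , _ , _ , _ , ca) (_ , _ , _ ∷ _ , _ , _ , _ , cb) =
    ⊥-elim (dollar≢code (trans ca (sym cb)))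
  two-linked-children⇒NewLetterChild _ (_ , _ , _ ∷ _ , _ , _ , _ , ca) (_ , _ , [] , _ , _ , _ , cb) =
    ⊥-elim (dollar≢code (trans cb (sym ca)))
  two-linked-children⇒NewLetterChild {u} {c} a≢b
    (ya , Qa , za ∷ _ , Va , Qa≡u , refl , ca) (yb , Qb , zb ∷ _ , Vb , Qb≡u , refl , cb) =
    Qa , za , za∉Qa , sym (extends Qa za Qa≡u ca)
    where
    extends : ∀ Q z → codes w Q ≡ u → code (lastCode (Q ∷ʳ z)) ≡ c → codes w (Q ∷ʳ z) ≡ u ∷ʳ c
    extends Q z Q≡u next≡c = trans (codes-∷ʳ Q z) (cong₂ _∷ʳ_ Q≡u next≡c)
    za∉Qa : za ∉ Qa
    za∉Qa za∈Qa = a≢b (cong code (lastCode-cong {ya ∷ Qa} {yb ∷ Qb} (≈-∷-∷ʳ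
      (codes≡⇒≈ (trans Va (sym Vb)))
      (codes≡⇒≈ (trans (extends Qa za Qa≡u ca) (sym (extends Qb zb Qb≡u cb))))
      za∈Qa)))

  ExplicitNonBranching⇒NewLetterChild : ∀ {u} → ExplicitNonBranching w u →
                       ∃[ c ] ((∀ b → IsNode w (u ++ [ b ]) → b ≡ c) × NewLetterChild u c)
  ExplicitNonBranching⇒NewLetterChild ((_ , inj₁ root) , ¬root , _) = ⊥-elim (¬root root)
  ExplicitNonBranching⇒NewLetterChild
    ((_ , inj₂ (inj₁ (_ , a , b , a≢b , node-a , node-b))) , _ , _ , _ , _ , only) =
    ⊥-elim (a≢b (trans (only a node-a) (sym (only b node-b))))
  ExplicitNonBranching⇒NewLetterChild ((_ , inj₂ (inj₂ (inj₁ leaf))) , _ , ¬leaf , _) = ⊥-elim (¬leaf leaf)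
  ExplicitNonBranching⇒NewLetterChild
    ((_ , inj₂ (inj₂ (inj₂ (i' , suc m , _ , i'+ℓ≤n , branching , u≡)))) , ¬root , _ , c , _ , only)
    with drop-∷ i' W (subst (i' <_) (sym length-W) (<-≤-trans (m<m+n i' (s≤s z≤n)) i'+ℓ≤n))
  ... | x , d with subst (λ D → Branching w (codes w (take (suc m) D))) d branching
  ...   | _ , a , b , a≢b , node-a , node-b =
    c , only , two-linked-children⇒NewLetterChild a≢b
                 (linked-child only ¬root u≡ node-a) (linked-child only ¬root u≡ node-b)

  record PrecedesNewLetter (D : List ℕ) (u : List Sym) : Set where
    constructor precedes
    field
      prefix : List ℕ
      letter : ℕ
      rest   : List ℕ
      split  : D ≡ prefix ++ letter ∷ rest
      fresh  : letter ∉ prefix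
      node≡  : u ≡ codes w prefix

  ExplicitNonBranching-on-path⇒PrecedesNewLetter : ∀ {i u} → i < n w → ExplicitNonBranching w u → u ⊑ Seq w i →
                                  PrecedesNewLetter (drop i W) u
  ExplicitNonBranching-on-path⇒PrecedesNewLetter {i} {u} i<n enb@(_ , _ , ¬leaf , _) u⊑
    with ExplicitNonBranching⇒NewLetterChild enb | path-child i<n u⊑ ¬leaf
  ... | c , only , Q , z , z∉Q , uc≡ | P , R , D≡ , u≡ , node = continue R D≡ (only _ node)
    where
    continue : ∀ R → drop i W ≡ P ++ R → after P R ≡ c → PrecedesNewLetter (drop i W) u
    continue [] _ $≡c =
      ⊥-elim (dollar≢code (trans $≡c (proj₂ (∷ʳ-injective u (codes w Q) (trans uc≡ (codes-∷ʳ Q z))))))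
    continue (z' ∷ R') D≡ next≡c = precedes P z' R' D≡ z'∉P u≡
      where
      Pz'≡Qz : codes w (P ∷ʳ z') ≡ codes w (Q ∷ʳ z)
      Pz'≡Qz = trans (codes-∷ʳ P z') (trans (cong₂ _∷ʳ_ (sym u≡) next≡c) uc≡)
      z'∉P : z' ∉ P
      z'∉P z'∈P = z∉Q (≈-∷ʳ-∈ (codes≡⇒≈ (sym Pz'≡Qz)) z'∈P)

  letter-at : ∀ {D u} (p : PrecedesNewLetter D u) → at D (length u) ≡ PrecedesNewLetter.letter p
  letter-at (precedes P z R refl _ refl) = trans (cong (at (P ++ z ∷ R)) (length-codes P)) (at-length-++ P)

  PrecedesNewLetter-count : ∀ {D} → All (_< σ) D →
                            ∀ {ns} → Unique ns → All (PrecedesNewLetter D) ns → length ns ≤ σ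
  PrecedesNewLetter-count {D} D<σ = Unique⇒length≤ (λ u → at D (length u)) same-letter⇒same-node letter<σ
    where
    same-letter⇒same-node : ∀ {u v} → PrecedesNewLetter D u → PrecedesNewLetter D v →
                            at D (length u) ≡ at D (length v) → u ≡ v
    same-letter⇒same-node {u} {v} p@(precedes P _ _ D≡ z∉P u≡) q@(precedes P' _ _ D≡' z∉P' v≡) same
      with trans (sym (letter-at p)) (trans same (letter-at q))
    ... | refl = begin
      u              ≡⟨ u≡ ⟩
      codes w P      ≡⟨ cong (codes w) (first-occurrence-unique (trans (sym D≡) D≡') z∉P z∉P') ⟩
      codes w P'     ≡⟨ v≡ ⟨
      v              ∎
      where open ≡-Reasoning
    letter<σ : ∀ {u} → PrecedesNewLetter D u → at D (length u) < σ
    letter<σ p@(precedes P z _ D≡ _ _) =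
      subst (_< σ) (sym (letter-at p)) (All.lookup D<σ (subst (z ∈_) (sym D≡) (∈-++⁺ʳ P (here refl))))

lemma6 : (σ : ℕ) (w : List (Fin σ)) →
    ((i : ℕ) → i < n w → (ns : List (List Sym)) → Unique ns →
       All (λ u → ExplicitNonBranching w u × u ⊑ Seq w i) ns → length ns ≤ σ)
    × ((u v : List Sym) → Branching w u → Branching w v → u ⊑ v →
       (ns : List (List Sym)) → Unique ns →
       All (λ x → ExplicitNonBranching w x × u ⊑ x × x ⊑ v) ns → length ns ≤ σ)
lemma6 σ w = on-path , between-branching
  where
  on-path : (i : ℕ) → i < n w → (ns : List (List Sym)) → Unique ns →
            All (λ u → ExplicitNonBranching w u × u ⊑ Seq w i) ns → length ns ≤ σ
  on-path i i<n ns uns enbs = PrecedesNewLetter-count w (Allₚ.drop⁺ i (letters<σ w)) uns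
    (All.map (λ (enb , u⊑) → ExplicitNonBranching-on-path⇒PrecedesNewLetter w i<n enb u⊑) enbs)
  between-branching : (u v : List Sym) → Branching w u → Branching w v → u ⊑ v →
                      (ns : List (List Sym)) → Unique ns →
                      All (λ x → ExplicitNonBranching w x × u ⊑ x × x ⊑ v) ns → length ns ≤ σ
  between-branching _ _ _ ((i , i<n , v⊑) , _) _ ns uns enbs =
    on-path i i<n ns uns (All.map (λ (enb , _ , x⊑v) → enb , ⊑-trans x⊑v v⊑) enbs)
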